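{- For all integers $n>0$, $t\ge 0$ and $1\le k\le n+1$, $$P(n+1,t,k)=\sum_{j\ge k-1}P(n,t,j)+\sum_{j\le k-2}P(n,t-1,j),$$ where $P(n,t,j)$ is interpreted as $0$ when $j\notin\{1,\dots,n\}$ or $t<0$.
   Context: Multi-pass stack sorting: in a pass, the entries of the current input are pushed one at a time, in order, onto a stack; whenever the top of the stack is the smallest value not yet output, it is popped to the output (repeatedly); entries are never popped otherwise. When all input entries have been pushed and no pop is possible, if the stack is nonempty the remaining entries are returned to the input in their original relative order and a new pass begins. The tier of a permutation is one less than the minimum number of passes needed to output $1,\dots,n$. For $n>0$, $t\ge 0$, $1\le k\le n$, $P(n,t,k)$ is the number of permutations of length $n$ with tier $t$ whose entry $1$ is in position $k$ (positions counted from the left). -}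

module Defs where

open import Data.Bool using (Bool; true; false; if_then_else_; _∧_)
open import Data.Nat using (ℕ; zero; suc; _+_; _∸_; _⊔_; _≡ᵇ_)
open import Data.List using (List; []; _∷_; length; map; concatMap; applyUpTo; filterᵇ; reverse)
open import Data.Nat.ListAction using (sum)
open import Data.Bool.ListAction using (all; any)
open import Data.Maybe using (Maybe; just; nothing)

-- One pass of stack sorting.
-- State: the stack (head = top) and m = smallest value not yet output.

record State : Set where
  constructor st
  field
    next  : ℕ
    stack : List ℕ
open State public

popAll : ℕ → List ℕ → State
popAll m []       = st m []
popAll m (y ∷ s)  = if y ≡ᵇ m then popAll (suc m) s else st m (y ∷ s)

runPass : State → List ℕ → State
runPass σ []       = σ
runPass σ (x ∷ xs) = runPass (popAll (next σ) (x ∷ stack σ)) xs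

-- one pass: given m and the current input, returns the new m and the
-- new input (remaining stack entries in their original relative order,
-- i.e. the order in which they were pushed = reverse of the stack)
pass : ℕ → List ℕ → State
pass m input with runPass (st m []) input
... | st m' s = st m' (reverse s)

-- number of passes needed until everything has been output, starting
-- with next value m; fuel bounds the number of passes (each pass outputs
-- at least one entry, so fuel = length of the input suffices)
passesFuel : ℕ → ℕ → List ℕ → ℕ
passesFuel fuel     m []        = 0
passesFuel zero     m (x ∷ xs)  = 0
passesFuel (suc f)  m (x ∷ xs) with pass m (x ∷ xs)
... | st m' rest = suc (passesFuel f m' rest)

passes : List ℕ → ℕ
passes w = passesFuel (length w) 1 w

tier : List ℕ → ℕ
tier w = passes w ∸ 1

words : ℕ → ℕ → List (List ℕ)
words n zero      = [] ∷ []
words n (suc len) = concatMap (λ w → applyUpTo (λ i → suc i ∷ w) n) (words n len)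

-- a word of length n over {1..n} is a permutation iff every j ∈ {1..n} occurs
isPermᵇ : ℕ → List ℕ → Bool
isPermᵇ n w = all (λ j → any (λ x → x ≡ᵇ j) w) (applyUpTo suc n)

perms : ℕ → List (List ℕ)
perms n = filterᵇ (isPermᵇ n) (words n n)

-- entry at position k (positions counted from 1 on the left)
atPos : ℕ → List ℕ → Maybe ℕ
atPos zero          _        = nothing
atPos (suc k)       []       = nothing
atPos (suc zero)    (x ∷ xs) = just x
atPos (suc (suc k)) (x ∷ xs) = atPos (suc k) xs

oneAtᵇ : ℕ → List ℕ → Bool
oneAtᵇ k w with atPos k w
... | just x  = x ≡ᵇ 1
... | nothing = false

P : ℕ → ℕ → ℕ → ℕ
P n t k = length (filterᵇ (λ w → (tier w ≡ᵇ t) ∧ oneAtᵇ k w) (perms n))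

-- P(n,t−1,j), interpreted as 0 when t − 1 < 0
Pprev : ℕ → ℕ → ℕ → ℕ
Pprev n zero    j = 0
Pprev n (suc t) j = P n t j

-- Σ_{j=a}^{b} f j   (empty when b < a)
ΣFromTo : ℕ → ℕ → (ℕ → ℕ) → ℕ
ΣFromTo a b f = sum (applyUpTo (λ i → f (a + i)) (suc b ∸ a))

-- Write u for the permutation of length n+1 obtained from a permutation w of length n by adding 1
-- to every entry and inserting a new entry 1 at position k, so that the old 1 becomes a 2.
-- If the 2 comes after the new 1, or immediately before it, then the first pass on u, as soon as
-- it has popped the new 1 (and in the second case the 2), is in the state of the first pass on w
-- shifted by one; so all later passes correspond and u has the tier of w.  If some entry lies
-- between the 2 and the new 1, then the first pass on u pops only the 1 and hands w, shifted by
-- one, to the second pass, so the tier of u is one more than that of w.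
-- As w ↦ u is a bijection onto the permutations with 1 at position k, sorting the w by the
-- position j of their entry 1 yields the recurrence.

module Submission where

open import Data.Bool using (Bool; true; false; if_then_else_; _∧_; T)
open import Data.Bool.Properties using (T-∧; ∧-identityʳ; ∧-zeroʳ)
open import Data.List using (List; []; _∷_; _++_; _ʳ++_; length; map; reverse; take; drop; applyUpTo; filterᵇ)
open import Data.List.Membership.Propositional using (_∈_; find; lose)
open import Data.List.Membership.Propositional.Properties
  using (∈-∃++; ∈-filter⁺; ∈-filter⁻; ∈-map⁺; ∈-map⁻; ∈-concatMap⁺; ∈-concatMap⁻;
         ∈-applyUpTo⁺; ∈-applyUpTo⁻)
open import Data.List.Membership.Propositional.Properties.WithK using (unique∧set⇒bag)
open import Data.List.Properties
  using (++-identityʳ; length-++; length-map; length-reverse; map-++; reverse-map; unfold-reverse; ʳ++-ʳ++;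
         take++drop≡id; map-∘; map-id; map-id-local; ∷-injectiveˡ; ∷-injectiveʳ)
open import Data.List.Relation.Binary.BagAndSetEquality using (∼bag⇒↭)
open import Data.List.Relation.Binary.Disjoint.Propositional using (Disjoint)
open import Data.List.Relation.Binary.Permutation.Propositional.Properties using (↭-length)
open import Data.List.Relation.Unary.All as All using (All; []; _∷_)
open import Data.List.Relation.Unary.All.Properties
  using (all⁺; all⁻; applyUpTo⁺₁; applyUpTo⁻; take⁺; drop⁺) renaming (map⁺ to All-map⁺)
import Data.List.Relation.Unary.AllPairs as AllPairs
import Data.List.Relation.Unary.AllPairs.Properties as AllPairs
open import Data.List.Relation.Unary.Any as Any using (here; there)
open import Data.List.Relation.Unary.Any.Properties using (any⁺; any⁻)
open import Data.List.Relation.Unary.Unique.Propositional using (Unique)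
import Data.List.Relation.Unary.Unique.Propositional.Properties as Unique
open import Data.Nat
open import Data.Nat.ListAction using (sum)
open import Data.Nat.Properties
open import Algebra.Properties.CommutativeSemigroup +-commutativeSemigroup
  using (interchange; x∙yz≈y∙xz; xy∙z≈y∙xz; xy∙z≈x∙zy)
open import Data.Product using (∃-syntax; _×_; _,_; proj₁; proj₂)
open import Data.Sum using (inj₁; inj₂)
open import Data.Unit using (tt)
open import Function using (_∘_; _⇔_; mk⇔; Equivalence)
open import Relation.Binary.PropositionalEquality
open import Relation.Nullary using (¬_; yes; no; contradiction)
open import Relation.Nullary.Decidable using (T?)

open import Defs

-- Indicators of intervals and occurrence counts

𝟙 : Bool → ℕ
𝟙 b = if b then 1 else 0

≡ᵇ-true⇒≡ : ∀ {x v} → (x ≡ᵇ v) ≡ true → x ≡ v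
≡ᵇ-true⇒≡ {x} {v} eq = ≡ᵇ⇒≡ x v (subst T (sym eq) tt)

≡ᵇ-false⇒≢ : ∀ {x v} → (x ≡ᵇ v) ≡ false → x ≢ v
≡ᵇ-false⇒≢ {x} {v} eq x≡v = subst T eq (≡⇒≡ᵇ x v x≡v)

≢⇒≡ᵇ-false : ∀ {x v} → x ≢ v → (x ≡ᵇ v) ≡ false
≢⇒≡ᵇ-false {x} {v} x≢v with x ≡ᵇ v in eq
... | true  = contradiction (≡ᵇ-true⇒≡ eq) x≢v
... | false = refl

χ[_,_⟩ : ℕ → ℕ → ℕ → ℕ
χ[ a , b ⟩ v = 𝟙 ((a ≤ᵇ v) ∧ (v <ᵇ b))

χ-inside : ∀ a b {v} → a ≤ v → v < b → χ[ a , b ⟩ v ≡ 1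
χ-inside a b {v} a≤v v<b with a ≤ᵇ v | ≤⇒≤ᵇ a≤v | v <ᵇ b | <⇒<ᵇ v<b
... | true | _ | true | _ = refl

χ-below : ∀ a b {v} → v < a → χ[ a , b ⟩ v ≡ 0
χ-below a b {v} v<a with a ≤ᵇ v in eq
... | false = refl
... | true  = contradiction (≤ᵇ⇒≤ a v (subst T (sym eq) tt)) (<⇒≱ v<a)

χ-above : ∀ a b {v} → b ≤ v → χ[ a , b ⟩ v ≡ 0
χ-above a b {v} b≤v with a ≤ᵇ v | v <ᵇ b in eq
... | false | _     = refl
... | true  | false = refl
... | true  | true  = contradiction (<ᵇ⇒< v b (subst T (sym eq) tt)) (≤⇒≯ b≤v)

χ-empty : ∀ a v → χ[ a , a ⟩ v ≡ 0
χ-empty a v with v <? a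
... | yes v<a = χ-below a a v<a
... | no  v≮a = χ-above a a (≮⇒≥ v≮a)

χ>0⇒inside : ∀ a b {v} → 0 < χ[ a , b ⟩ v → a ≤ v × v < b
χ>0⇒inside a b {v} χ>0 with v <? a | v <? b
... | yes v<a | _       = contradiction (χ-below a b v<a) (>⇒≢ χ>0)
... | no  _   | no  v≮b = contradiction (χ-above a b (≮⇒≥ v≮b)) (>⇒≢ χ>0)
... | no  v≮a | yes v<b = ≮⇒≥ v≮a , v<b

χ-split : ∀ {a b c} v → a ≤ b → b ≤ c → χ[ a , b ⟩ v + χ[ b , c ⟩ v ≡ χ[ a , c ⟩ v
χ-split {a} {b} {c} v a≤b b≤c with v <? a | v <? b | v <? c
... | yes v<a | _       | _
  rewrite χ-below a b v<a | χ-below b c (<-≤-trans v<a a≤b) | χ-below a c v<a = refl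
... | no v≮a  | yes v<b | _
  rewrite χ-inside a b (≮⇒≥ v≮a) v<b | χ-below b c v<b | χ-inside a c (≮⇒≥ v≮a) (<-≤-trans v<b b≤c) = refl
... | no v≮a  | no v≮b  | yes v<c
  rewrite χ-above a b (≮⇒≥ v≮b) | χ-inside b c (≮⇒≥ v≮b) v<c | χ-inside a c (≮⇒≥ v≮a) v<c = refl
... | no v≮a  | no v≮b  | no v≮c
  rewrite χ-above a b (≮⇒≥ v≮b) | χ-above b c (≮⇒≥ v≮c) | χ-above a c (≮⇒≥ v≮c) = refl

χ-suc : ∀ a b v → χ[ suc a , suc b ⟩ (suc v) ≡ χ[ a , b ⟩ v
χ-suc zero    b v = refl
χ-suc (suc a) b v = refl

χ-singleton : ∀ m v → χ[ m , suc m ⟩ v ≡ 𝟙 (m ≡ᵇ v)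
χ-singleton zero    zero    = refl
χ-singleton zero    (suc v) = refl
χ-singleton (suc m) zero    = refl
χ-singleton (suc m) (suc v) = trans (χ-suc m (suc m) v) (χ-singleton m v)

χ-from-1-suc : ∀ l v → χ[ 1 , 2 + l ⟩ (suc v) ≡ 𝟙 (0 ≡ᵇ v) + χ[ 1 , 1 + l ⟩ v
χ-from-1-suc l v = begin
  χ[ 1 , 2 + l ⟩ (suc v)                  ≡⟨ χ-suc 0 (1 + l) v ⟩
  χ[ 0 , 1 + l ⟩ v                        ≡⟨ sym (χ-split v z≤n (s≤s z≤n)) ⟩
  χ[ 0 , 1 ⟩ v + χ[ 1 , 1 + l ⟩ v         ≡⟨ cong (_+ χ[ 1 , 1 + l ⟩ v) (χ-singleton 0 v) ⟩
  𝟙 (0 ≡ᵇ v) + χ[ 1 , 1 + l ⟩ v           ∎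
  where open ≡-Reasoning

occ : ℕ → List ℕ → ℕ
occ v []       = 0
occ v (x ∷ xs) = 𝟙 (x ≡ᵇ v) + occ v xs

occ-++ : ∀ v xs ys → occ v (xs ++ ys) ≡ occ v xs + occ v ys
occ-++ v []       ys = refl
occ-++ v (x ∷ xs) ys = trans (cong (𝟙 (x ≡ᵇ v) +_) (occ-++ v xs ys)) (sym (+-assoc (𝟙 (x ≡ᵇ v)) _ _))

occ-reverse : ∀ v xs → occ v (reverse xs) ≡ occ v xs
occ-reverse v []       = refl
occ-reverse v (x ∷ xs) = begin
  occ v (reverse (x ∷ xs))               ≡⟨ cong (occ v) (unfold-reverse x xs) ⟩
  occ v (reverse xs ++ x ∷ [])           ≡⟨ occ-++ v (reverse xs) (x ∷ []) ⟩
  occ v (reverse xs) + (𝟙 (x ≡ᵇ v) + 0)  ≡⟨ cong₂ _+_ (occ-reverse v xs) (+-identityʳ _) ⟩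
  occ v xs + 𝟙 (x ≡ᵇ v)                  ≡⟨ +-comm (occ v xs) _ ⟩
  occ v (x ∷ xs)                         ∎
  where open ≡-Reasoning

occ-map-suc : ∀ v xs → occ (suc v) (map suc xs) ≡ occ v xs
occ-map-suc v []       = refl
occ-map-suc v (x ∷ xs) = cong (𝟙 (x ≡ᵇ v) +_) (occ-map-suc v xs)

occ-zero-map-suc : ∀ xs → occ 0 (map suc xs) ≡ 0
occ-zero-map-suc []       = refl
occ-zero-map-suc (x ∷ xs) = occ-zero-map-suc xs

occ>0⇒∈ : ∀ {v xs} → 0 < occ v xs → v ∈ xs
occ>0⇒∈ {v} {x ∷ xs} occ>0 with x ≡ᵇ v in eq
... | true  = here (sym (≡ᵇ-true⇒≡ eq))
... | false = there (occ>0⇒∈ occ>0)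

∈⇒occ>0 : ∀ {v xs} → v ∈ xs → 0 < occ v xs
∈⇒occ>0 {v} (here refl) with v ≡ᵇ v | ≡⇒≡ᵇ v v refl
... | true | _ = s≤s z≤n
∈⇒occ>0 {v} (there {x} v∈xs) = ≤-trans (∈⇒occ>0 v∈xs) (m≤n+m _ (𝟙 (x ≡ᵇ v)))

occ≡0⇒∉ : ∀ {v} xs → occ v xs ≡ 0 → ¬ (v ∈ xs)
occ≡0⇒∉ xs occ≡0 v∈xs = >⇒≢ (∈⇒occ>0 v∈xs) occ≡0

∉⇒occ≡0 : ∀ {v} xs → ¬ (v ∈ xs) → occ v xs ≡ 0
∉⇒occ≡0 xs v∉xs = n≤0⇒n≡0 (≮⇒≥ (v∉xs ∘ occ>0⇒∈))

All<⇒occ≡0 : ∀ {m v xs} → All (m <_) xs → v ≤ m → occ v xs ≡ 0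
All<⇒occ≡0 []                         v≤m = refl
All<⇒occ≡0 {v = v} (_∷_ {x} m<x above) v≤m with x ≡ᵇ v in eq
... | true  = contradiction (≡ᵇ-true⇒≡ eq) (>⇒≢ (≤-<-trans v≤m m<x))
... | false = All<⇒occ≡0 above v≤m

occ≡0⇒All< : ∀ {m xs} → All (m ≤_) xs → occ m xs ≡ 0 → All (m <_) xs
occ≡0⇒All< []                           _     = []
occ≡0⇒All< {m} (_∷_ {x} m≤x atLeast) occ≡0 with x ≡ᵇ m in eq
... | false = ≤∧≢⇒< m≤x (≢-sym (≡ᵇ-false⇒≢ eq)) ∷ occ≡0⇒All< atLeast occ≡0

occ-0-1≡0⇒All>1 : ∀ {xs} → occ 0 xs ≡ 0 → occ 1 xs ≡ 0 → All (1 <_) xs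
occ-0-1≡0⇒All>1 {xs} no0 no1 = occ≡0⇒All< (occ≡0⇒All< (All.universal (λ _ → z≤n) xs) no0) no1

IsIntervalFrom : ℕ → List ℕ → Set
IsIntervalFrom m w = ∀ v → occ v w ≡ χ[ m , m + length w ⟩ v

interval-∋-start : ∀ {m} x xs → IsIntervalFrom m (x ∷ xs) → m ∈ x ∷ xs
interval-∋-start {m} x xs interval =
  occ>0⇒∈ (subst (0 <_) (sym (trans (interval m) (χ-inside m (m + suc (length xs)) ≤-refl (m<m+n m z<s)))) z<s)


-- Finite sums and counting

∑ : ℕ → (ℕ → ℕ) → ℕ
∑ l f = sum (applyUpTo f l)

∑-cong : ∀ l {f g} → (∀ {i} → i < l → f i ≡ g i) → ∑ l f ≡ ∑ l g
∑-cong zero    f≗g = refl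
∑-cong (suc l) f≗g = cong₂ _+_ (f≗g z<s) (∑-cong l (f≗g ∘ s<s))

∑-zero : ∀ l → ∑ l (λ _ → 0) ≡ 0
∑-zero zero    = refl
∑-zero (suc l) = ∑-zero l

∑-+ : ∀ l f g → ∑ l (λ i → f i + g i) ≡ ∑ l f + ∑ l g
∑-+ zero    f g = refl
∑-+ (suc l) f g =
  trans (cong (f 0 + g 0 +_) (∑-+ l (f ∘ suc) (g ∘ suc))) (interchange (f 0) (g 0) _ _)

∑-split : ∀ a b f → ∑ (a + b) f ≡ ∑ a f + ∑ b (λ i → f (a + i))
∑-split zero    b f = refl
∑-split (suc a) b f = trans (cong (f 0 +_) (∑-split a b (f ∘ suc))) (sym (+-assoc (f 0) _ _))

∑-𝟙-≡ᵇ : ∀ {j l} → j < l → ∑ l (λ i → 𝟙 (j ≡ᵇ i)) ≡ 1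
∑-𝟙-≡ᵇ {zero}  {suc l} _         = cong suc (∑-zero l)
∑-𝟙-≡ᵇ {suc j} {suc l} (s<s j<l) = ∑-𝟙-≡ᵇ j<l

∑-≥ : ∀ l {f} → (∀ {i} → i < l → 1 ≤ f i) → l ≤ ∑ l f
∑-≥ zero    pos = z≤n
∑-≥ (suc l) pos = +-mono-≤ (pos z<s) (∑-≥ l (pos ∘ s<s))

+-squeeze : ∀ {x y l} → 1 ≤ x → l ≤ y → x + y ≡ suc l → x ≡ 1 × y ≡ l
+-squeeze {suc x} {y} {l} _ l≤y x+y≡ = cong suc x≡0 , trans (cong (_+ y) (sym x≡0)) x+y≡l
  where
    x+y≡l : x + y ≡ l
    x+y≡l = suc-injective x+y≡
    x≡0 : x ≡ 0
    x≡0 = n≤0⇒n≡0 (+-cancelʳ-≤ y x 0 (subst (_≤ y) (sym x+y≡l) l≤y))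

∑≡length⇒all-one : ∀ l {f} → (∀ {i} → i < l → 1 ≤ f i) → ∑ l f ≡ l → ∀ {i} → i < l → f i ≡ 1
∑≡length⇒all-one (suc l) pos ∑≡ {i} i<l with +-squeeze (pos z<s) (∑-≥ l (pos ∘ s<s)) ∑≡ | i
... | head≡1 , _      | zero   = head≡1
... | _      , tail≡  | suc i′ = ∑≡length⇒all-one l (pos ∘ s<s) tail≡ (s<s⁻¹ i<l)

InRange : ℕ → ℕ → Set
InRange n x = 1 ≤ x × x ≤ n

∑-occ : ∀ n {u} → All (InRange n) u → ∑ n (λ i → occ (suc i) u) ≡ length u
∑-occ n []                             = ∑-zero n
∑-occ n (_∷_ {suc j} {u} (_ , j<n) inRange) =
  trans (∑-+ n (λ i → 𝟙 (j ≡ᵇ i)) (λ i → occ (suc i) u)) (cong₂ _+_ (∑-𝟙-≡ᵇ j<n) (∑-occ n inRange))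

length-filterᵇ-∷ : ∀ {A : Set} (p : A → Bool) x L → length (filterᵇ p (x ∷ L)) ≡ 𝟙 (p x) + length (filterᵇ p L)
length-filterᵇ-∷ p x L with p x
... | true  = refl
... | false = refl

length-filterᵇ-by-position : ∀ {A : Set} N (p : A → Bool) (q : ℕ → A → Bool) L →
  (∀ {x} → x ∈ L → ∃[ j ] j < N × ∀ i → q i x ≡ (j ≡ᵇ i)) →
  length (filterᵇ p L) ≡ ∑ N (λ i → length (filterᵇ (λ x → p x ∧ q i x) L))
length-filterᵇ-by-position N p q []      _        = sym (∑-zero N)
length-filterᵇ-by-position N p q (x ∷ L) position = begin
  length (filterᵇ p (x ∷ L))
    ≡⟨ length-filterᵇ-∷ p x L ⟩
  𝟙 (p x) + length (filterᵇ p L)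
    ≡⟨ cong₂ _+_ (split-x (position (here refl))) (length-filterᵇ-by-position N p q L (position ∘ there)) ⟩
  ∑ N (λ i → 𝟙 (p x ∧ q i x)) + ∑ N (λ i → length (filterᵇ (λ y → p y ∧ q i y) L))
    ≡⟨ sym (∑-+ N _ _) ⟩
  ∑ N (λ i → 𝟙 (p x ∧ q i x) + length (filterᵇ (λ y → p y ∧ q i y) L))
    ≡⟨ ∑-cong N (λ {i} _ → sym (length-filterᵇ-∷ (λ y → p y ∧ q i y) x L)) ⟩
  ∑ N (λ i → length (filterᵇ (λ y → p y ∧ q i y) (x ∷ L))) ∎
  where
    open ≡-Reasoning
    split-x : (∃[ j ] j < N × ∀ i → q i x ≡ (j ≡ᵇ i)) → 𝟙 (p x) ≡ ∑ N (λ i → 𝟙 (p x ∧ q i x))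
    split-x (j , j<N , q≡) = trans (by-cases (p x)) (∑-cong N (λ {i} _ → cong (λ b → 𝟙 (p x ∧ b)) (sym (q≡ i))))
      where
        by-cases : ∀ b → 𝟙 b ≡ ∑ N (λ i → 𝟙 (b ∧ (j ≡ᵇ i)))
        by-cases true  = sym (∑-𝟙-≡ᵇ j<N)
        by-cases false = sym (∑-zero N)

filterᵇ-cong-∈ : ∀ {A : Set} {p q : A → Bool} L → (∀ {x} → x ∈ L → p x ≡ q x) → filterᵇ p L ≡ filterᵇ q L
filterᵇ-cong-∈ {p = p} {q} []      _   = refl
filterᵇ-cong-∈ {p = p} {q} (x ∷ L) p≡q with p x | q x | p≡q (here refl)
... | true  | true  | _ = cong (x ∷_) (filterᵇ-cong-∈ L (p≡q ∘ there))
... | false | false | _ = filterᵇ-cong-∈ L (p≡q ∘ there)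

filterᵇ-false : ∀ {A : Set} (L : List A) → filterᵇ (λ _ → false) L ≡ []
filterᵇ-false []      = refl
filterᵇ-false (_ ∷ L) = filterᵇ-false L

∧-congʳ-T : ∀ {x y} b → (T b → x ≡ y) → x ∧ b ≡ y ∧ b
∧-congʳ-T {x} {y} true  x≡y = trans (∧-identityʳ x) (trans (x≡y tt) (sym (∧-identityʳ y)))
∧-congʳ-T {x} {y} false _   = trans (∧-zeroʳ x) (sym (∧-zeroʳ y))

unique-same-elements⇒length≡ : ∀ {A : Set} {xs ys : List A} → Unique xs → Unique ys →
  (∀ {x} → x ∈ xs ⇔ x ∈ ys) → length xs ≡ length ys
unique-same-elements⇒length≡ xs! ys! same = ↭-length (∼bag⇒↭ (unique∧set⇒bag xs! ys! same))


-- Passes of stack sorting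

shift : State → State
shift σ = st (suc (next σ)) (map suc (stack σ))

popAll-shift : ∀ m s → popAll (suc m) (map suc s) ≡ shift (popAll m s)
popAll-shift m []      = refl
popAll-shift m (y ∷ s) with y ≡ᵇ m
... | true  = popAll-shift (suc m) s
... | false = refl

runPass-shift : ∀ σ xs → runPass (shift σ) (map suc xs) ≡ shift (runPass σ xs)
runPass-shift σ []       = refl
runPass-shift σ (x ∷ xs) rewrite popAll-shift (next σ) (x ∷ stack σ) =
  runPass-shift (popAll (next σ) (x ∷ stack σ)) xs

pass-from-runPass : ∀ m m′ u w → runPass (st m []) u ≡ shift (runPass (st m′ []) w) →
  pass m u ≡ shift (pass m′ w)
pass-from-runPass m m′ u w eq rewrite eq =
  cong (st _) (sym (reverse-map suc (stack (runPass (st m′ []) w))))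

pass-shift : ∀ m w → pass (suc m) (map suc w) ≡ shift (pass m w)
pass-shift m w = pass-from-runPass (suc m) m (map suc w) w (runPass-shift (st m []) w)

passesFuel-shift : ∀ f m w → passesFuel f (suc m) (map suc w) ≡ passesFuel f m w
passesFuel-shift zero    m []      = refl
passesFuel-shift zero    m (x ∷ w) = refl
passesFuel-shift (suc f) m []      = refl
passesFuel-shift (suc f) m (x ∷ w) =
  trans (cong (λ σ → suc (passesFuel f (next σ) (stack σ))) (pass-shift m (x ∷ w)))
        (cong suc (passesFuel-shift f (next (pass m (x ∷ w))) (stack (pass m (x ∷ w)))))

runPass-++ : ∀ σ xs ys → runPass σ (xs ++ ys) ≡ runPass (runPass σ xs) ys
runPass-++ σ []       ys = refl
runPass-++ σ (x ∷ xs) ys = runPass-++ _ xs ys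

popAll-blocked : ∀ {m} y s → y ≢ m → popAll m (y ∷ s) ≡ st m (y ∷ s)
popAll-blocked {m} y s y≢m with y ≡ᵇ m in eq
... | true  = contradiction (≡ᵇ-true⇒≡ eq) y≢m
... | false = refl

popAll-noPop : ∀ {m} s → occ m s ≡ 0 → popAll m s ≡ st m s
popAll-noPop []      _     = refl
popAll-noPop (y ∷ s) occ≡0 = popAll-blocked y s (λ y≡m → occ≡0⇒∉ (y ∷ s) occ≡0 (here (sym y≡m)))

popAll-blocked-ʳ++ : ∀ {m} x xs s → occ m (x ∷ xs) ≡ 0 → popAll m ((x ∷ xs) ʳ++ s) ≡ st m ((x ∷ xs) ʳ++ s)
popAll-blocked-ʳ++ x []       s occ≡0 = popAll-blocked x s (λ x≡m → occ≡0⇒∉ (x ∷ []) occ≡0 (here (sym x≡m)))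
popAll-blocked-ʳ++ x (y ∷ xs) s occ≡0 = popAll-blocked-ʳ++ y xs (x ∷ s) (m+n≡0⇒n≡0 (𝟙 (x ≡ᵇ _)) occ≡0)

runPass-noPop : ∀ {m} s xs → occ m xs ≡ 0 → runPass (st m s) xs ≡ st m (xs ʳ++ s)
runPass-noPop     s []       _     = refl
runPass-noPop {m} s (x ∷ xs) occ≡0 = trans (cong (λ σ → runPass σ xs) (popAll-blocked x s x≢m))
                                           (runPass-noPop (x ∷ s) xs (m+n≡0⇒n≡0 (𝟙 (x ≡ᵇ m)) occ≡0))
  where
    x≢m : x ≢ m
    x≢m x≡m = occ≡0⇒∉ (x ∷ xs) occ≡0 (here (sym x≡m))

runPass-noPop-prefix : ∀ {m} s xs ys → occ m xs ≡ 0 → runPass (st m s) (xs ++ ys) ≡ runPass (st m (xs ʳ++ s)) ys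
runPass-noPop-prefix s xs ys occ≡0 = trans (runPass-++ _ xs ys) (cong (λ σ → runPass σ ys) (runPass-noPop s xs occ≡0))

popAll-pops : ∀ m s → popAll m (m ∷ s) ≡ popAll (suc m) s
popAll-pops m s with m ≡ᵇ m | ≡⇒≡ᵇ m m refl
... | true | _ = refl

popAll-next-≥ : ∀ m s → m ≤ next (popAll m s)
popAll-next-≥ m []      = ≤-refl
popAll-next-≥ m (y ∷ s) with y ≡ᵇ m
... | true  = ≤-trans (n≤1+n m) (popAll-next-≥ (suc m) s)
... | false = ≤-refl

popAll-occ : ∀ m s v → occ v s ≡ occ v (stack (popAll m s)) + χ[ m , next (popAll m s) ⟩ v
popAll-occ m []      v = sym (χ-empty m v)
popAll-occ m (y ∷ s) v with y ≡ᵇ m in eq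
... | false = sym (trans (cong (occ v (y ∷ s) +_) (χ-empty m v)) (+-identityʳ _))
... | true  with refl ← ≡ᵇ-true⇒≡ {y} {m} eq = begin
  𝟙 (m ≡ᵇ v) + occ v s                               ≡⟨ cong₂ _+_ (sym (χ-singleton m v)) (popAll-occ (suc m) s v) ⟩
  χ[ m , suc m ⟩ v + (occ v S′ + χ[ suc m , M′ ⟩ v)  ≡⟨ x∙yz≈y∙xz (χ[ m , suc m ⟩ v) (occ v S′) _ ⟩
  occ v S′ + (χ[ m , suc m ⟩ v + χ[ suc m , M′ ⟩ v)  ≡⟨ cong (occ v S′ +_) (χ-split v (n≤1+n m) (popAll-next-≥ (suc m) s)) ⟩
  occ v S′ + χ[ m , M′ ⟩ v                           ∎
  where
    open ≡-Reasoning
    S′ = stack (popAll (suc m) s)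
    M′ = next (popAll (suc m) s)

popAll-length : ∀ m s → length s + m ≡ length (stack (popAll m s)) + next (popAll m s)
popAll-length m []      = refl
popAll-length m (y ∷ s) with y ≡ᵇ m
... | true  = trans (sym (+-suc (length s) m)) (popAll-length (suc m) s)
... | false = refl

runPass-next-≥ : ∀ σ xs → next σ ≤ next (runPass σ xs)
runPass-next-≥ σ []       = ≤-refl
runPass-next-≥ σ (x ∷ xs) =
  ≤-trans (popAll-next-≥ (next σ) (x ∷ stack σ)) (runPass-next-≥ (popAll (next σ) (x ∷ stack σ)) xs)

runPass-occ : ∀ σ xs v →
  occ v xs + occ v (stack σ) ≡ occ v (stack (runPass σ xs)) + χ[ next σ , next (runPass σ xs) ⟩ v
runPass-occ σ []       v = sym (trans (cong (occ v (stack σ) +_) (χ-empty (next σ) v)) (+-identityʳ _))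
runPass-occ σ (x ∷ xs) v = begin
  𝟙 (x ≡ᵇ v) + occ v xs + occ v (stack σ)                ≡⟨ xy∙z≈y∙xz (𝟙 (x ≡ᵇ v)) (occ v xs) _ ⟩
  occ v xs + occ v (x ∷ stack σ)                         ≡⟨ cong (occ v xs +_) (popAll-occ (next σ) (x ∷ stack σ) v) ⟩
  occ v xs + (occ v (stack τ) + χ[ next σ , next τ ⟩ v)  ≡⟨ sym (+-assoc (occ v xs) _ _) ⟩
  occ v xs + occ v (stack τ) + χ[ next σ , next τ ⟩ v    ≡⟨ cong (_+ χ[ next σ , next τ ⟩ v) (runPass-occ τ xs v) ⟩
  occ v S′ + χ[ next τ , M′ ⟩ v + χ[ next σ , next τ ⟩ v ≡⟨ xy∙z≈x∙zy (occ v S′) _ _ ⟩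
  occ v S′ + (χ[ next σ , next τ ⟩ v + χ[ next τ , M′ ⟩ v)
    ≡⟨ cong (occ v S′ +_) (χ-split v (popAll-next-≥ (next σ) (x ∷ stack σ)) (runPass-next-≥ τ xs)) ⟩
  occ v S′ + χ[ next σ , M′ ⟩ v                          ∎
  where
    open ≡-Reasoning
    τ  = popAll (next σ) (x ∷ stack σ)
    S′ = stack (runPass τ xs)
    M′ = next (runPass τ xs)

runPass-length : ∀ σ xs →
  length xs + (length (stack σ) + next σ) ≡ length (stack (runPass σ xs)) + next (runPass σ xs)
runPass-length σ []       = refl
runPass-length σ (x ∷ xs) = begin
  suc (length xs + (length (stack σ) + next σ))  ≡⟨ sym (+-suc (length xs) _) ⟩
  length xs + (length (x ∷ stack σ) + next σ)    ≡⟨ cong (length xs +_) (popAll-length (next σ) (x ∷ stack σ)) ⟩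
  length xs + (length (stack τ) + next τ)        ≡⟨ runPass-length τ xs ⟩
  length (stack (runPass τ xs)) + next (runPass τ xs) ∎
  where
    open ≡-Reasoning
    τ = popAll (next σ) (x ∷ stack σ)

runPass-advances : ∀ σ xs → next σ ∈ xs → next σ < next (runPass σ xs)
runPass-advances (st m s) (x ∷ xs) (here refl) = begin-strict
  m                                  <⟨ n<1+n m ⟩
  suc m                              ≤⟨ popAll-next-≥ (suc m) s ⟩
  next (popAll (suc m) s)            ≡⟨ cong next (sym (popAll-pops m s)) ⟩
  next (popAll m (m ∷ s))            ≤⟨ runPass-next-≥ (popAll m (m ∷ s)) xs ⟩
  next (runPass (popAll m (m ∷ s)) xs) ∎
  where open ≤-Reasoning
runPass-advances (st m s) (x ∷ xs) (there m∈xs) with m≤n⇒m<n∨m≡n (popAll-next-≥ m (x ∷ s))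
... | inj₁ m<next = <-≤-trans m<next (runPass-next-≥ τ xs)
  where τ = popAll m (x ∷ s)
... | inj₂ m≡next = subst (_< next (runPass τ xs)) (sym m≡next) (runPass-advances τ xs (subst (_∈ xs) m≡next m∈xs))
  where τ = popAll m (x ∷ s)

pass-progress : ∀ m x xs → IsIntervalFrom m (x ∷ xs) →
  let σ = pass m (x ∷ xs) in IsIntervalFrom (next σ) (stack σ) × length (stack σ) ≤ length xs
pass-progress m x xs interval = interval′ , ≤-pred shorter
  where
    w = x ∷ xs
    L = length w
    M = next (runPass (st m []) w)
    s = stack (runPass (st m []) w)
    m<M : m < M
    m<M = runPass-advances (st m []) w (interval-∋-start x xs interval)
    s+M≡m+L : length s + M ≡ m + L
    s+M≡m+L = trans (sym (runPass-length (st m []) w)) (+-comm L m)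
    interval′ : IsIntervalFrom M (reverse s)
    interval′ v = begin
      occ v (reverse s)                  ≡⟨ occ-reverse v s ⟩
      occ v s                            ≡⟨ +-cancelʳ-≡ (χ[ m , M ⟩ v) _ _ split-occ ⟩
      χ[ M , m + L ⟩ v                   ≡⟨ cong (λ b → χ[ M , b ⟩ v) (trans (sym s+M≡m+L) (+-comm (length s) M)) ⟩
      χ[ M , M + length s ⟩ v            ≡⟨ cong (λ l → χ[ M , M + l ⟩ v) (sym (length-reverse s)) ⟩
      χ[ M , M + length (reverse s) ⟩ v  ∎
      where
        open ≡-Reasoning
        split-occ : occ v s + χ[ m , M ⟩ v ≡ χ[ M , m + L ⟩ v + χ[ m , M ⟩ v
        split-occ = begin
          occ v s + χ[ m , M ⟩ v           ≡⟨ sym (runPass-occ (st m []) w v) ⟩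
          occ v w + 0                      ≡⟨ trans (+-identityʳ _) (interval v) ⟩
          χ[ m , m + L ⟩ v                 ≡⟨ sym (χ-split v (<⇒≤ m<M) (subst (M ≤_) s+M≡m+L (m≤n+m M (length s)))) ⟩
          χ[ m , M ⟩ v + χ[ M , m + L ⟩ v  ≡⟨ +-comm (χ[ m , M ⟩ v) _ ⟩
          χ[ M , m + L ⟩ v + χ[ m , M ⟩ v  ∎
    shorter : length (reverse s) < L
    shorter = subst (_< L) (sym (length-reverse s))
      (+-cancelʳ-< M (length s) L (subst (_< L + M) (sym s+M≡m+L) (subst (m + L <_) (+-comm M L) (+-monoˡ-< L m<M))))

passesFuel-suc : ∀ f {m} w → IsIntervalFrom m w → length w ≤ f → passesFuel (suc f) m w ≡ passesFuel f m w
passesFuel-suc f       []       _        _             = refl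
passesFuel-suc (suc f) {m} (x ∷ xs) interval (s≤s len≤f)
  with interval′ , shorter ← pass-progress m x xs interval =
  cong suc (passesFuel-suc f (stack (pass m (x ∷ xs))) interval′ (≤-trans shorter len≤f))

tier-when-first-pass-shifted : ∀ u w → IsIntervalFrom 1 w → length u ≡ suc (length w) →
  pass 1 u ≡ shift (pass 1 w) → tier u ≡ tier w
tier-when-first-pass-shifted (z ∷ zs) [] _ _ pass≡ = cong (λ σ → passesFuel (length zs) (next σ) (stack σ)) pass≡
tier-when-first-pass-shifted (z ∷ zs) (x ∷ xs) interval len≡ pass≡
  with interval′ , shorter ← pass-progress 1 x xs interval = begin
  passesFuel (length zs) (next (pass 1 (z ∷ zs))) (stack (pass 1 (z ∷ zs)))
    ≡⟨ cong (λ σ → passesFuel (length zs) (next σ) (stack σ)) pass≡ ⟩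
  passesFuel (length zs) (suc M) (map suc R)  ≡⟨ passesFuel-shift (length zs) M R ⟩
  passesFuel (length zs) M R                  ≡⟨ cong (λ f → passesFuel f M R) (suc-injective len≡) ⟩
  passesFuel (suc (length xs)) M R            ≡⟨ passesFuel-suc (length xs) R interval′ shorter ⟩
  passesFuel (length xs) M R                  ∎
  where
    open ≡-Reasoning
    M = next (pass 1 (x ∷ xs))
    R = stack (pass 1 (x ∷ xs))

tier-when-first-pass-outputs-only-1 : ∀ u w → w ≢ [] → length u ≡ suc (length w) →
  pass 1 u ≡ st 2 (map suc w) → tier u ≡ suc (tier w)
tier-when-first-pass-outputs-only-1 _        []       w≢[] _    _     = contradiction refl w≢[]
tier-when-first-pass-outputs-only-1 (z ∷ zs) (x ∷ xs) _    len≡ pass≡ = begin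
  passesFuel (length zs) (next (pass 1 (z ∷ zs))) (stack (pass 1 (z ∷ zs)))
    ≡⟨ cong (λ σ → passesFuel (length zs) (next σ) (stack σ)) pass≡ ⟩
  passesFuel (length zs) 2 (map suc (x ∷ xs))  ≡⟨ passesFuel-shift (length zs) 1 (x ∷ xs) ⟩
  passesFuel (length zs) 1 (x ∷ xs)            ≡⟨ cong (λ f → passesFuel f 1 (x ∷ xs)) (suc-injective len≡) ⟩
  passes (x ∷ xs)                              ∎
  where open ≡-Reasoning


-- The first pass after inserting a new entry 1

no-1-in-map-suc : ∀ {x} → All (1 <_) x → occ 1 (map suc x) ≡ 0
no-1-in-map-suc {x} x>1 = trans (occ-map-suc 0 x) (All<⇒occ≡0 x>1 z≤n)

no-2-in-map-suc : ∀ {x} → All (1 <_) x → occ 2 (map suc x) ≡ 0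
no-2-in-map-suc {x} x>1 = trans (occ-map-suc 1 x) (All<⇒occ≡0 x>1 ≤-refl)

runPass-1-before-2 : ∀ x y → All (1 <_) x →
  runPass (st 1 []) (map suc x ++ 1 ∷ map suc y) ≡ shift (runPass (st 1 []) (x ++ y))
runPass-1-before-2 x y x>1 = begin
  runPass (st 1 []) (map suc x ++ 1 ∷ map suc y)         ≡⟨ runPass-noPop-prefix [] (map suc x) _ (no-1-in-map-suc x>1) ⟩
  runPass (popAll 2 (reverse (map suc x))) (map suc y)   ≡⟨ cong (λ σ → runPass σ (map suc y)) (popAll-noPop _ no2) ⟩
  runPass (st 2 (reverse (map suc x))) (map suc y)       ≡⟨ cong (λ s → runPass (st 2 s) (map suc y)) (sym (reverse-map suc x)) ⟩
  runPass (shift (st 1 (reverse x))) (map suc y)         ≡⟨ runPass-shift (st 1 (reverse x)) y ⟩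
  shift (runPass (st 1 (reverse x)) y)                   ≡⟨ cong shift (sym (runPass-noPop-prefix [] x y (All<⇒occ≡0 x>1 ≤-refl))) ⟩
  shift (runPass (st 1 []) (x ++ y))                     ∎
  where
    open ≡-Reasoning
    no2 : occ 2 (reverse (map suc x)) ≡ 0
    no2 = trans (occ-reverse 2 (map suc x)) (no-2-in-map-suc x>1)

runPass-2-adjacent-1 : ∀ x y → All (1 <_) x →
  runPass (st 1 []) (map suc x ++ 2 ∷ 1 ∷ map suc y) ≡ shift (runPass (st 1 []) (x ++ 1 ∷ y))
runPass-2-adjacent-1 x y x>1 = begin
  runPass (st 1 []) (map suc x ++ 2 ∷ 1 ∷ map suc y)     ≡⟨ runPass-noPop-prefix [] (map suc x) _ (no-1-in-map-suc x>1) ⟩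
  runPass (popAll 3 (reverse (map suc x))) (map suc y)   ≡⟨ cong (λ s → runPass (popAll 3 s) (map suc y)) (sym (reverse-map suc x)) ⟩
  runPass (popAll 3 (map suc (reverse x))) (map suc y)   ≡⟨ cong (λ σ → runPass σ (map suc y)) (popAll-shift 2 (reverse x)) ⟩
  runPass (shift (popAll 2 (reverse x))) (map suc y)     ≡⟨ runPass-shift (popAll 2 (reverse x)) y ⟩
  shift (runPass (st 1 (reverse x)) (1 ∷ y))             ≡⟨ cong shift (sym (runPass-noPop-prefix [] x (1 ∷ y) (All<⇒occ≡0 x>1 ≤-refl))) ⟩
  shift (runPass (st 1 []) (x ++ 1 ∷ y))                 ∎
  where open ≡-Reasoning

pass-2-gap-1 : ∀ a z p y → All (1 <_) a → All (1 <_) (z ∷ p) → All (1 <_) y →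
  pass 1 (map suc a ++ 2 ∷ map suc (z ∷ p) ++ 1 ∷ map suc y) ≡ st 2 (map suc (a ++ 1 ∷ z ∷ p ++ y))
pass-2-gap-1 a z p y a>1 zp>1 y>1 =
  trans (cong (λ σ → st (next σ) (reverse (stack σ))) run) (cong (st 2) reversed)
  where
    A = map suc a
    Z = map suc (z ∷ p)
    Y = map suc y
    S = Z ʳ++ 2 ∷ reverse A
    run : runPass (st 1 []) (A ++ 2 ∷ Z ++ 1 ∷ Y) ≡ st 2 (Y ʳ++ S)
    run = begin
      runPass (st 1 []) (A ++ 2 ∷ Z ++ 1 ∷ Y)    ≡⟨ runPass-noPop-prefix [] A _ (no-1-in-map-suc a>1) ⟩
      runPass (st 1 (2 ∷ reverse A)) (Z ++ 1 ∷ Y) ≡⟨ runPass-noPop-prefix (2 ∷ reverse A) Z _ (no-1-in-map-suc zp>1) ⟩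
      runPass (popAll 2 S) Y
        ≡⟨ cong (λ σ → runPass σ Y) (popAll-blocked-ʳ++ (suc z) (map suc p) _ (no-2-in-map-suc zp>1)) ⟩
      runPass (st 2 S) Y                          ≡⟨ runPass-noPop S Y (no-2-in-map-suc y>1) ⟩
      st 2 (Y ʳ++ S)                              ∎
      where open ≡-Reasoning
    reversed : reverse (Y ʳ++ S) ≡ map suc (a ++ 1 ∷ z ∷ p ++ y)
    reversed = begin
      (Y ʳ++ S) ʳ++ []                    ≡⟨ ʳ++-ʳ++ Y ⟩
      S ʳ++ Y ++ []                       ≡⟨ ʳ++-ʳ++ Z ⟩
      reverse A ʳ++ 2 ∷ Z ++ Y ++ []      ≡⟨ ʳ++-ʳ++ A ⟩
      A ++ 2 ∷ Z ++ Y ++ []               ≡⟨ cong (λ r → A ++ 2 ∷ Z ++ r) (++-identityʳ Y) ⟩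
      A ++ 2 ∷ Z ++ Y                     ≡⟨ cong (λ r → A ++ 2 ∷ r) (sym (map-++ suc (z ∷ p) y)) ⟩
      A ++ map suc (1 ∷ z ∷ p ++ y)       ≡⟨ sym (map-++ suc a (1 ∷ z ∷ p ++ y)) ⟩
      map suc (a ++ 1 ∷ z ∷ p ++ y)       ∎
      where open ≡-Reasoning


-- Permutations and the insertion of a new minimum

IsPerm : ℕ → List ℕ → Set
IsPerm n w = length w ≡ n × IsIntervalFrom 1 w

perm⇒All>0 : ∀ {n w} → IsPerm n w → All (0 <_) w
perm⇒All>0 {w = w} (_ , interval) = occ≡0⇒All< (All.universal (λ _ → z≤n) w) (interval 0)

record SplitAtOne (w : List ℕ) : Set where
  field
    before after : List ℕ
    split    : w ≡ before ++ 1 ∷ after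
    before>1 : All (1 <_) before
    after>1  : All (1 <_) after

perm-splitAtOne : ∀ {n} w → IsPerm (suc n) w → SplitAtOne w
perm-splitAtOne (x ∷ xs) (_ , interval) with a , b , w≡ ← ∈-∃++ (interval-∋-start x xs interval) = record
  { before = a ; after = b ; split = w≡
  ; before>1 = occ-0-1≡0⇒All>1 (m+n≡0⇒m≡0 _ no0) (m+n≡0⇒m≡0 _ no1)
  ; after>1  = occ-0-1≡0⇒All>1 (m+n≡0⇒n≡0 (occ 0 a) no0) (m+n≡0⇒n≡0 (occ 1 a) no1)
  }
  where
    occ-split : ∀ v → occ v a + occ v (1 ∷ b) ≡ χ[ 1 , 1 + length (x ∷ xs) ⟩ v
    occ-split v = trans (sym (occ-++ v a (1 ∷ b))) (trans (cong (occ v) (sym w≡)) (interval v))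
    no0 : occ 0 a + occ 0 b ≡ 0
    no0 = occ-split 0
    no1 : occ 1 a + occ 1 b ≡ 0
    no1 = suc-injective (trans (sym (+-suc (occ 1 a) (occ 1 b)))
                               (trans (occ-split 1) (χ-inside 1 (1 + length (x ∷ xs)) ≤-refl (s<s z<s))))

oneAtᵇ-All>1 : ∀ {xs} → All (1 <_) xs → ∀ k → oneAtᵇ k xs ≡ false
oneAtᵇ-All>1 []            zero          = refl
oneAtᵇ-All>1 []            (suc k)       = refl
oneAtᵇ-All>1 (_   ∷ _)     zero          = refl
oneAtᵇ-All>1 (1<x ∷ _)     (suc zero)    = ≢⇒≡ᵇ-false (>⇒≢ 1<x)
oneAtᵇ-All>1 (_   ∷ rest)  (suc (suc k)) = oneAtᵇ-All>1 rest (suc k)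

oneAtᵇ-split : ∀ {a b} → All (1 <_) a → All (1 <_) b → ∀ i → oneAtᵇ (suc i) (a ++ 1 ∷ b) ≡ (length a ≡ᵇ i)
oneAtᵇ-split []          b>1 zero    = refl
oneAtᵇ-split []          b>1 (suc i) = oneAtᵇ-All>1 b>1 (suc i)
oneAtᵇ-split (1<x ∷ _)   b>1 zero    = ≢⇒≡ᵇ-false (>⇒≢ 1<x)
oneAtᵇ-split (_ ∷ a>1)   b>1 (suc i) = oneAtᵇ-split a>1 b>1 i

length-before-1 : ∀ {w i} (s : SplitAtOne w) → T (oneAtᵇ (suc i) w) → length (SplitAtOne.before s) ≡ i
length-before-1 {i = i} s at-i = ≡ᵇ⇒≡ _ i (subst T (trans (cong (oneAtᵇ (suc i)) split) (oneAtᵇ-split before>1 after>1 i)) at-i)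
  where open SplitAtOne s

perm-position-of-1 : ∀ {n} w → IsPerm (suc n) w → ∃[ j ] j < suc n × ∀ i → oneAtᵇ (suc i) w ≡ (j ≡ᵇ i)
perm-position-of-1 {n} w perm@(len≡ , _) =
  length before , j<n , λ i → trans (cong (oneAtᵇ (suc i)) split) (oneAtᵇ-split before>1 after>1 i)
  where
    open SplitAtOne (perm-splitAtOne w perm)
    j<n : length before < suc n
    j<n = subst (length before <_) (trans (cong length (sym split)) len≡)
            (subst (length before <_) (sym (length-++ before)) (m<m+n (length before) z<s))

-- The permutation u of the proof idea, with the new 1 at position k = c + 1.
insert1 : ℕ → List ℕ → List ℕ
insert1 c w = map suc (take c w) ++ 1 ∷ map suc (drop c w)

length-insert1 : ∀ c w → length (insert1 c w) ≡ suc (length w)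
length-insert1 zero    w       = cong suc (length-map suc w)
length-insert1 (suc c) []      = refl
length-insert1 (suc c) (x ∷ w) = cong suc (length-insert1 c w)

insert1-++ : ∀ x d r → insert1 (length x + d) (x ++ r) ≡ map suc x ++ insert1 d r
insert1-++ []      d r = refl
insert1-++ (y ∷ x) d r = cong (suc y ∷_) (insert1-++ x d r)

oneAtᵇ-insert1 : ∀ c w → c ≤ length w → T (oneAtᵇ (suc c) (insert1 c w))
oneAtᵇ-insert1 zero    w       _          = tt
oneAtᵇ-insert1 (suc c) (x ∷ w) (s≤s c≤w) = oneAtᵇ-insert1 c w c≤w

occ-zero-insert1 : ∀ c w → occ 0 (insert1 c w) ≡ 0
occ-zero-insert1 zero    w       = occ-zero-map-suc w
occ-zero-insert1 (suc c) []      = refl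
occ-zero-insert1 (suc c) (x ∷ w) = occ-zero-insert1 c w

occ-suc-insert1 : ∀ c w v → occ (suc v) (insert1 c w) ≡ 𝟙 (0 ≡ᵇ v) + occ v w
occ-suc-insert1 zero    w       v = cong (𝟙 (0 ≡ᵇ v) +_) (occ-map-suc v w)
occ-suc-insert1 (suc c) []      v = refl
occ-suc-insert1 (suc c) (x ∷ w) v =
  trans (cong (𝟙 (x ≡ᵇ v) +_) (occ-suc-insert1 c w v)) (x∙yz≈y∙xz (𝟙 (x ≡ᵇ v)) (𝟙 (0 ≡ᵇ v)) (occ v w))

insert1-perm : ∀ {n} c w → IsPerm n w → IsPerm (suc n) (insert1 c w)
insert1-perm c w (len≡ , interval) = trans (length-insert1 c w) (cong suc len≡) , interval′
  where
    interval′ : IsIntervalFrom 1 (insert1 c w)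
    interval′ zero    = occ-zero-insert1 c w
    interval′ (suc v) = begin
      occ (suc v) (insert1 c w)                  ≡⟨ occ-suc-insert1 c w v ⟩
      𝟙 (0 ≡ᵇ v) + occ v w                       ≡⟨ cong (𝟙 (0 ≡ᵇ v) +_) (interval v) ⟩
      𝟙 (0 ≡ᵇ v) + χ[ 1 , 1 + length w ⟩ v       ≡⟨ sym (χ-from-1-suc (length w) v) ⟩
      χ[ 1 , 2 + length w ⟩ (suc v)              ≡⟨ cong (λ l → χ[ 1 , 1 + l ⟩ (suc v)) (sym (length-insert1 c w)) ⟩
      χ[ 1 , 1 + length (insert1 c w) ⟩ (suc v)  ∎
      where open ≡-Reasoning

insert1-perm⁻ : ∀ {n} c w → IsPerm (suc n) (insert1 c w) → IsPerm n w
insert1-perm⁻ c w (len≡ , interval′) = suc-injective (trans (sym (length-insert1 c w)) len≡) , interval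
  where
    interval : IsIntervalFrom 1 w
    interval v = +-cancelˡ-≡ (𝟙 (0 ≡ᵇ v)) _ _ (begin
      𝟙 (0 ≡ᵇ v) + occ v w                       ≡⟨ sym (occ-suc-insert1 c w v) ⟩
      occ (suc v) (insert1 c w)                  ≡⟨ interval′ (suc v) ⟩
      χ[ 1 , 1 + length (insert1 c w) ⟩ (suc v)  ≡⟨ cong (λ l → χ[ 1 , 1 + l ⟩ (suc v)) (length-insert1 c w) ⟩
      χ[ 1 , 2 + length w ⟩ (suc v)              ≡⟨ χ-from-1-suc (length w) v ⟩
      𝟙 (0 ≡ᵇ v) + χ[ 1 , 1 + length w ⟩ v       ∎)
      where open ≡-Reasoning

remove1 : List ℕ → List ℕ
remove1 []       = []
remove1 (x ∷ xs) = if x ≡ᵇ 1 then map pred xs else pred x ∷ remove1 xs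

remove1-insert1 : ∀ c {w} → All (0 <_) w → remove1 (insert1 c w) ≡ w
remove1-insert1 zero    {w} _                        = trans (sym (map-∘ w)) (map-id w)
remove1-insert1 (suc c)     []                       = refl
remove1-insert1 (suc c)     (_∷_ {suc x} _ positive) = cong (suc x ∷_) (remove1-insert1 c positive)

insert1-map-pred : ∀ {a b} → All (0 <_) a → All (0 <_) b → insert1 (length a) (map pred (a ++ b)) ≡ a ++ 1 ∷ b
insert1-map-pred {b = b} [] b>0 = cong (1 ∷_) (trans (sym (map-∘ b)) (map-id-local (All.map (λ { {suc _} _ → refl }) b>0)))
insert1-map-pred (_∷_ {suc x} _ a>0) b>0 = cong (suc x ∷_) (insert1-map-pred a>0 b>0)

All-take-++ : ∀ {P : ℕ → Set} c {a} r → c ≤ length a → All P a → All P (take c (a ++ r))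
All-take-++ zero    r _         _          = []
All-take-++ (suc c) r (s≤s c≤a) (px ∷ pxs) = px ∷ All-take-++ c r c≤a pxs

++-∷≢[] : ∀ (a : List ℕ) {x b} → a ++ x ∷ b ≢ []
++-∷≢[] []      ()
++-∷≢[] (_ ∷ _) ()

tier-insert1-≤-split : ∀ c a b → IsIntervalFrom 1 (a ++ 1 ∷ b) → All (1 <_) a → c ≤ suc (length a) →
  tier (insert1 c (a ++ 1 ∷ b)) ≡ tier (a ++ 1 ∷ b)
tier-insert1-≤-split c a b interval a>1 c≤ =
  tier-when-first-pass-shifted (insert1 c w) w interval (length-insert1 c w) (pass-from-runPass 1 1 (insert1 c w) w runs)
  where
    w = a ++ 1 ∷ b
    runs : runPass (st 1 []) (insert1 c w) ≡ shift (runPass (st 1 []) w)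
    runs with m≤n⇒m<n∨m≡n c≤
    ... | inj₁ (s≤s c≤a) = trans (runPass-1-before-2 (take c w) (drop c w) (All-take-++ c (1 ∷ b) c≤a a>1))
                                 (cong (λ v → shift (runPass (st 1 []) v)) (take++drop≡id c w))
    ... | inj₂ refl      = trans (cong (runPass (st 1 [])) (trans (cong (λ c → insert1 c w) (+-comm 1 (length a)))
                                                                    (insert1-++ a 1 (1 ∷ b))))
                                 (runPass-2-adjacent-1 a b a>1)

tier-insert1->-split : ∀ c a b → All (1 <_) a → All (1 <_) b → 2 + length a ≤ c → c ≤ length (a ++ 1 ∷ b) →
  tier (insert1 c (a ++ 1 ∷ b)) ≡ suc (tier (a ++ 1 ∷ b))
tier-insert1->-split c a []      _   _   late≤c c≤len =
  contradiction (subst (2 + length a ≤_) (trans (length-++ a) (+-comm (length a) 1)) (≤-trans late≤c c≤len)) (<-irrefl refl)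
tier-insert1->-split c a (z ∷ b) a>1 b>1 late≤c c≤len with d , refl ← m≤n⇒∃[o]m+o≡n late≤c =
  tier-when-first-pass-outputs-only-1 (insert1 c w) w (++-∷≢[] a) (length-insert1 c w) first-pass
  where
    w = a ++ 1 ∷ z ∷ b
    c≡ : length a + (2 + d) ≡ 2 + length a + d
    c≡ = trans (+-suc (length a) (suc d)) (cong suc (+-suc (length a) d))
    first-pass : pass 1 (insert1 (2 + length a + d) w) ≡ st 2 (map suc w)
    first-pass = begin
      pass 1 (insert1 (2 + length a + d) w)
        ≡⟨ cong (λ c → pass 1 (insert1 c w)) (sym c≡) ⟩
      pass 1 (insert1 (length a + (2 + d)) w)
        ≡⟨ cong (pass 1) (insert1-++ a (2 + d) (1 ∷ z ∷ b)) ⟩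
      pass 1 (map suc a ++ 2 ∷ map suc (z ∷ take d b) ++ 1 ∷ map suc (drop d b))
        ≡⟨ pass-2-gap-1 a z (take d b) (drop d b) a>1 (take⁺ (suc d) b>1) (drop⁺ (suc d) b>1) ⟩
      st 2 (map suc (a ++ 1 ∷ z ∷ take d b ++ drop d b))
        ≡⟨ cong (λ v → st 2 (map suc (a ++ 1 ∷ z ∷ v))) (take++drop≡id d b) ⟩
      st 2 (map suc w) ∎
      where open ≡-Reasoning

tier-insert1-≤ : ∀ {n w i} c → IsPerm (suc n) w → T (oneAtᵇ (suc i) w) → c ≤ suc i → tier (insert1 c w) ≡ tier w
tier-insert1-≤ {n} {w} c perm at-i c≤ = subst (λ w → tier (insert1 c w) ≡ tier w) (sym split)
  (tier-insert1-≤-split c before after (subst (IsIntervalFrom 1) split (proj₂ perm)) before>1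
    (subst (λ i → c ≤ suc i) (sym (length-before-1 s at-i)) c≤))
  where
    s = perm-splitAtOne w perm
    open SplitAtOne s

tier-insert1-> : ∀ {n w i} c → IsPerm (suc n) w → T (oneAtᵇ (suc i) w) → 2 + i ≤ c → c ≤ suc n →
  tier (insert1 c w) ≡ suc (tier w)
tier-insert1-> {n} {w} c perm at-i late≤c c≤n = subst (λ w → tier (insert1 c w) ≡ suc (tier w)) (sym split)
  (tier-insert1->-split c before after before>1 after>1
    (subst (λ i → 2 + i ≤ c) (sym (length-before-1 s at-i)) late≤c)
    (subst (c ≤_) (trans (sym (proj₁ perm)) (cong length split)) c≤n))
  where
    s = perm-splitAtOne w perm
    open SplitAtOne s


-- Enumerating permutations

∈-words⁻ : ∀ n len {u} → u ∈ words n len → length u ≡ len × All (InRange n) u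
∈-words⁻ n zero    (here refl) = refl , []
∈-words⁻ n (suc len) u∈
  with w , w∈ , u∈ext ← find (∈-concatMap⁻ (λ w → applyUpTo (λ i → suc i ∷ w) n) {xs = words n len} u∈)
  with i , i<n , refl ← ∈-applyUpTo⁻ (λ i → suc i ∷ w) u∈ext
  with len≡ , inRange ← ∈-words⁻ n len w∈
  = cong suc len≡ , (s≤s z≤n , i<n) ∷ inRange

∈-words⁺ : ∀ n len {u} → length u ≡ len → All (InRange n) u → u ∈ words n len
∈-words⁺ n zero    {[]}    _    []                     = here refl
∈-words⁺ n (suc len) {suc x ∷ u} len≡ ((_ , x<n) ∷ inRange) =
  ∈-concatMap⁺ (λ w → applyUpTo (λ i → suc i ∷ w) n)
    (lose (∈-words⁺ n len (suc-injective len≡) inRange) (∈-applyUpTo⁺ (λ i → suc i ∷ u) x<n))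

words-unique : ∀ n len → Unique (words n len)
words-unique n zero      = [] AllPairs.∷ AllPairs.[]
words-unique n (suc len) =
  Unique.concat⁺ (All-map⁺ (All.universal extensions-unique (words n len)))
                 (AllPairs.map⁺ (AllPairs.map extensions-disjoint (words-unique n len)))
  where
    extensions : List ℕ → List (List ℕ)
    extensions w = applyUpTo (λ i → suc i ∷ w) n
    extensions-unique : ∀ w → Unique (extensions w)
    extensions-unique w = Unique.applyUpTo⁺₁ _ n (λ i<j _ eq → <⇒≢ i<j (suc-injective (∷-injectiveˡ eq)))
    extensions-disjoint : ∀ {w w′} → w ≢ w′ → Disjoint (extensions w) (extensions w′)
    extensions-disjoint w≢w′ (v∈ , v∈′)
      with _ , _ , refl ← ∈-applyUpTo⁻ _ v∈
      with _ , _ , eq ← ∈-applyUpTo⁻ _ v∈′ = w≢w′ (∷-injectiveʳ eq)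

perms-unique : ∀ n → Unique (perms n)
perms-unique n = Unique.filter⁺ (T? ∘ isPermᵇ n) (words-unique n n)

isPermᵇ⇒covers : ∀ n u → T (isPermᵇ n u) → ∀ {i} → i < n → suc i ∈ u
isPermᵇ⇒covers n u isPerm i<n =
  Any.map (λ {x} eq → sym (≡ᵇ⇒≡ x _ eq)) (any⁻ _ u (applyUpTo⁻ suc n (all⁺ _ _ isPerm) i<n))

covers⇒isPermᵇ : ∀ n u → (∀ {i} → i < n → suc i ∈ u) → T (isPermᵇ n u)
covers⇒isPermᵇ n u covers =
  all⁻ _ (applyUpTo⁺₁ suc n (λ i<n → any⁺ _ (Any.map (λ {x} eq → ≡⇒≡ᵇ x _ (sym eq)) (covers i<n))))

∈-perms⁻ : ∀ n {u} → u ∈ perms n → IsPerm n u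
∈-perms⁻ n {u} u∈ with u∈words , isPerm ← ∈-filter⁻ (T? ∘ isPermᵇ n) {xs = words n n} u∈
                    with len≡ , inRange ← ∈-words⁻ n n u∈words = len≡ , interval
  where
    once : ∀ {i} → i < n → occ (suc i) u ≡ 1
    once = ∑≡length⇒all-one n (∈⇒occ>0 ∘ isPermᵇ⇒covers n u isPerm) (trans (∑-occ n inRange) len≡)
    interval : IsIntervalFrom 1 u
    interval zero    = ∉⇒occ≡0 u (λ 0∈u → contradiction (proj₁ (All.lookup inRange 0∈u)) (λ ()))
    interval (suc i) with i <? n
    ... | yes i<n = trans (once i<n) (sym (χ-inside 1 (1 + length u) (s≤s z≤n) (s<s (subst (i <_) (sym len≡) i<n))))
    ... | no  i≮n = trans (∉⇒occ≡0 u (λ i+1∈u → i≮n (proj₂ (All.lookup inRange i+1∈u))))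
                          (sym (χ-above 1 (1 + length u) (s≤s (subst (_≤ i) (sym len≡) (≮⇒≥ i≮n)))))

∈-perms⁺ : ∀ n {u} → IsPerm n u → u ∈ perms n
∈-perms⁺ n {u} (len≡ , interval) =
  ∈-filter⁺ (T? ∘ isPermᵇ n) (∈-words⁺ n n len≡ (All.tabulate inRange)) (covers⇒isPermᵇ n u covers)
  where
    interval′ : ∀ v → occ v u ≡ χ[ 1 , suc n ⟩ v
    interval′ v = trans (interval v) (cong (λ l → χ[ 1 , suc l ⟩ v) len≡)
    inRange : ∀ {x} → x ∈ u → InRange n x
    inRange x∈u with 1≤x , x<1+n ← χ>0⇒inside 1 (suc n) (subst (0 <_) (interval′ _) (∈⇒occ>0 x∈u)) = 1≤x , ≤-pred x<1+n
    covers : ∀ {i} → i < n → suc i ∈ u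
    covers i<n = occ>0⇒∈ (subst (0 <_) (sym (trans (interval′ _) (χ-inside 1 (suc n) (s≤s z≤n) (s<s i<n)))) z<s)


P-via-insert1 : ∀ n t c → c ≤ n → P (suc n) t (suc c) ≡ length (filterᵇ (λ w → tier (insert1 c w) ≡ᵇ t) (perms n))
P-via-insert1 n t c c≤n = begin
  length A                    ≡⟨ unique-same-elements⇒length≡ A-unique image-unique (mk⇔ to from) ⟩
  length (map (insert1 c) B)  ≡⟨ length-map (insert1 c) B ⟩
  length B                    ∎
  where
    open ≡-Reasoning
    p : List ℕ → Bool
    p u = (tier u ≡ᵇ t) ∧ oneAtᵇ (suc c) u
    q : List ℕ → Bool
    q w = tier (insert1 c w) ≡ᵇ t
    A = filterᵇ p (perms (suc n))
    B = filterᵇ q (perms n)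
    A-unique : Unique A
    A-unique = Unique.filter⁺ (T? ∘ p) (perms-unique (suc n))
    image-unique : Unique (map (insert1 c) B)
    image-unique = Unique.map⁻ (subst Unique (sym remove1-image) (Unique.filter⁺ (T? ∘ q) (perms-unique n)))
      where
        remove1-image : map remove1 (map (insert1 c) B) ≡ B
        remove1-image = trans (sym (map-∘ B)) (map-id-local (All.tabulate λ w∈B →
          remove1-insert1 c (perm⇒All>0 (∈-perms⁻ n (proj₁ (∈-filter⁻ (T? ∘ q) {xs = perms n} w∈B))))))
    to : ∀ {u} → u ∈ A → u ∈ map (insert1 c) B
    to {u} u∈A with u∈perms , pu ← ∈-filter⁻ (T? ∘ p) {xs = perms (suc n)} u∈A
               with tier≡ , at-c ← Equivalence.to T-∧ pu =
      subst (_∈ map (insert1 c) B) insert1-w≡u (∈-map⁺ (insert1 c) w∈B)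
      where
        perm = ∈-perms⁻ (suc n) u∈perms
        s = perm-splitAtOne u perm
        open SplitAtOne s
        w = map pred (before ++ after)
        insert1-w≡u : insert1 c w ≡ u
        insert1-w≡u = begin
          insert1 c w                 ≡⟨ cong (λ c → insert1 c w) (sym (length-before-1 s at-c)) ⟩
          insert1 (length before) w   ≡⟨ insert1-map-pred (All.map <⇒≤ before>1) (All.map <⇒≤ after>1) ⟩
          before ++ 1 ∷ after         ≡⟨ sym split ⟩
          u                           ∎
        w∈B : w ∈ B
        w∈B = ∈-filter⁺ (T? ∘ q) (∈-perms⁺ n (insert1-perm⁻ c w (subst (IsPerm (suc n)) (sym insert1-w≡u) perm)))
                (subst (λ v → T (tier v ≡ᵇ t)) (sym insert1-w≡u) tier≡)
    from : ∀ {u} → u ∈ map (insert1 c) B → u ∈ A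
    from u∈image with w , w∈B , refl ← ∈-map⁻ (insert1 c) u∈image
                 with w∈perms , tier≡ ← ∈-filter⁻ (T? ∘ q) {xs = perms n} w∈B =
      ∈-filter⁺ (T? ∘ p) (∈-perms⁺ (suc n) (insert1-perm c w perm))
                (Equivalence.from T-∧ (tier≡ , oneAtᵇ-insert1 c w c≤w))
      where
        perm = ∈-perms⁻ n w∈perms
        c≤w = subst (c ≤_) (sym (proj₁ perm)) c≤n

count-insert1-≤ : ∀ n c t i → c ≤ suc i →
  length (filterᵇ (λ w → (tier (insert1 c w) ≡ᵇ t) ∧ oneAtᵇ (suc i) w) (perms (suc n))) ≡ P (suc n) t (suc i)
count-insert1-≤ n c t i c≤ = cong length (filterᵇ-cong-∈ (perms (suc n)) λ {w} w∈ →
  ∧-congʳ-T (oneAtᵇ (suc i) w) (λ at-i → cong (_≡ᵇ t) (tier-insert1-≤ c (∈-perms⁻ (suc n) w∈) at-i c≤)))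

count-insert1-> : ∀ n c t i → 2 + i ≤ c → c ≤ suc n →
  length (filterᵇ (λ w → (tier (insert1 c w) ≡ᵇ t) ∧ oneAtᵇ (suc i) w) (perms (suc n))) ≡ Pprev (suc n) t (suc i)
count-insert1-> n c t i late≤c c≤n = trans (cong length (filterᵇ-cong-∈ (perms (suc n)) λ {w} w∈ →
  ∧-congʳ-T (oneAtᵇ (suc i) w) (λ at-i → cong (_≡ᵇ t) (tier-insert1-> c (∈-perms⁻ (suc n) w∈) at-i late≤c c≤n))))
  (by-tier t)
  where
    by-tier : ∀ t → length (filterᵇ (λ w → (suc (tier w) ≡ᵇ t) ∧ oneAtᵇ (suc i) w) (perms (suc n))) ≡
                    Pprev (suc n) t (suc i)
    by-tier zero    = cong length (filterᵇ-false (perms (suc n)))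
    by-tier (suc t) = refl

count-by-position-of-1 : ∀ n c t → c ≤ suc n →
  length (filterᵇ (λ w → tier (insert1 c w) ≡ᵇ t) (perms (suc n))) ≡
    ΣFromTo (suc (c ∸ 1)) (suc n) (P (suc n) t) + ΣFromTo 1 (c ∸ 1) (Pprev (suc n) t)
count-by-position-of-1 n c t c≤ = begin
  length (filterᵇ (λ w → tier (insert1 c w) ≡ᵇ t) (perms (suc n)))
    ≡⟨ length-filterᵇ-by-position (suc n) _ (oneAtᵇ ∘ suc) (perms (suc n))
         (λ {w} w∈ → perm-position-of-1 w (∈-perms⁻ (suc n) w∈)) ⟩
  ∑ (suc n) count
    ≡⟨ cong (λ l → ∑ l count) (sym (m+[n∸m]≡n (≤-trans (m∸n≤m c 1) c≤))) ⟩
  ∑ (d + (suc n ∸ d)) count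
    ≡⟨ ∑-split d (suc n ∸ d) count ⟩
  ∑ d count + ∑ (suc n ∸ d) (λ i → count (d + i))
    ≡⟨ cong₂ _+_ (∑-cong d (λ i<d → count-insert1-> n c t _ (late c i<d) c≤))
                 (∑-cong (suc n ∸ d) (λ {i} _ →
                    count-insert1-≤ n c t (d + i) (≤-trans (m≤n+m∸n c 1) (s≤s (m≤m+n d i))))) ⟩
  ∑ d (λ i → Pprev (suc n) t (suc i)) + ∑ (suc n ∸ d) (λ i → P (suc n) t (suc d + i))
    ≡⟨ +-comm (∑ d (λ i → Pprev (suc n) t (suc i))) _ ⟩
  ΣFromTo (suc d) (suc n) (P (suc n) t) + ΣFromTo 1 d (Pprev (suc n) t) ∎
  where
    open ≡-Reasoning
    d = c ∸ 1
    count : ℕ → ℕ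
    count i = length (filterᵇ (λ w → (tier (insert1 c w) ≡ᵇ t) ∧ oneAtᵇ (suc i) w) (perms (suc n)))
    late : ∀ c {i} → i < c ∸ 1 → 2 + i ≤ c
    late (suc c) i<c = s≤s i<c

m⊔1≡1+[m∸1] : ∀ m → m ⊔ 1 ≡ suc (m ∸ 1)
m⊔1≡1+[m∸1] zero    = refl
m⊔1≡1+[m∸1] (suc m) = cong suc (⊔-identityʳ m)

theorem4p9 : (n t k : ℕ) → 1 ≤ n → 1 ≤ k → k ≤ suc n →
    P (suc n) t k ≡
      ΣFromTo ((k ∸ 1) ⊔ 1) n (λ j → P n t j) + ΣFromTo 1 (k ∸ 2) (λ j → Pprev n t j)
theorem4p9 (suc n) t (suc c) _ _ (s≤s c≤) = begin
  P (suc (suc n)) t (suc c)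
    ≡⟨ P-via-insert1 (suc n) t c c≤ ⟩
  length (filterᵇ (λ w → tier (insert1 c w) ≡ᵇ t) (perms (suc n)))
    ≡⟨ count-by-position-of-1 n c t c≤ ⟩
  ΣFromTo (suc (c ∸ 1)) (suc n) (P (suc n) t) + ΣFromTo 1 (c ∸ 1) (Pprev (suc n) t)
    ≡⟨ cong (λ a → ΣFromTo a (suc n) (P (suc n) t) + ΣFromTo 1 (c ∸ 1) (Pprev (suc n) t)) (sym (m⊔1≡1+[m∸1] c)) ⟩
  ΣFromTo (c ⊔ 1) (suc n) (P (suc n) t) + ΣFromTo 1 (c ∸ 1) (Pprev (suc n) t) ∎
  where open ≡-Reasoning
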